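{- Let $C$ be an indecomposable $q$-ary linear code of dimension $k$ and let $B$ be a basis of $C$ consisting of codewords of minimum weight. Then there exists a chain $\emptyset=B_0\subseteq B_1\subseteq\cdots\subseteq B_k=B$ with $\#B_i=i$ for all $i$, such that every subcode $C_i=\langle B_i\rangle$ of $C$ is indecomposable.
   Context: A $q$-ary linear code of length $n$ is an $\mathbb{F}_q$-subspace of $\mathbb{F}_q^n$; the weight of a vector is its number of nonzero coordinates, and codewords of minimum weight are nonzero codewords of smallest weight among nonzero codewords. A code $C$ is decomposable if there are nonzero subcodes $D,D'$ with $D+D'=C$ and $\mathrm{supp}(D)\cap\mathrm{supp}(D')=\emptyset$, where $\mathrm{supp}(D)$ is the set of coordinates at which some codeword of $D$ is nonzero; otherwise it is indecomposable. In particular, zero codes and one-dimensional codes are indecomposable. -}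

module Defs where

open import Level using (Level; _⊔_) renaming (suc to lsuc)
open import Data.Nat using (ℕ; zero; suc; _≤_) renaming (_+_ to _+ℕ_)
open import Data.Fin using (Fin; zero; suc; toℕ; inject₁; fromℕ)
open import Data.Fin.Subset using (Subset; ∣_∣; _⊆_; _∉_; ⊥; ⊤)
open import Data.Product using (Σ; ∃; ∃-syntax; _×_; _,_)
open import Relation.Nullary using (¬_; does)
open import Relation.Binary using (Decidable)
open import Relation.Binary.PropositionalEquality using (_≡_)
open import Data.Bool using (if_then_else_)
open import Algebra.Bundles using (CommutativeRing)

record FiniteField c ℓ : Set (lsuc (c ⊔ ℓ)) where
  field
    commRing : CommutativeRing c ℓ
  open CommutativeRing commRing public
  field
    _≟_       : Decidable _≈_
    1≉0       : ¬ (1# ≈ 0#)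
    inverse   : ∀ x → ¬ (x ≈ 0#) → Σ Carrier (λ y → (x * y) ≈ 1#)
    q         : ℕ
    enum      : Fin q → Carrier
    enum-surj : ∀ x → Σ (Fin q) (λ i → enum i ≈ x)

module Codes {c ℓ : Level} (F : FiniteField c ℓ) (n : ℕ) where
  open FiniteField F using (Carrier; _≈_; _+_; _*_; 0#; _≟_)

  Word : Set c
  Word = Fin n → Carrier

  _≈w_ : Word → Word → Set ℓ
  u ≈w v = ∀ i → u i ≈ v i

  0w : Word
  0w i = 0#

  _+w_ : Word → Word → Word
  (u +w v) i = u i + v i

  _•w_ : Carrier → Word → Word
  (a •w v) i = a * v i

  NonZeroWord : Word → Set ℓ
  NonZeroWord v = ∃[ i ] ¬ (v i ≈ 0#)

  weight : ∀ {m} → (Fin m → Carrier) → ℕ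
  weight {zero}  v = 0
  weight {suc m} v = (if does (v zero ≟ 0#) then 0 else 1) +ℕ weight (λ i → v (suc i))

  -- sets of words (a code is such a set which is a subspace)
  WSet : Set (lsuc (c ⊔ ℓ))
  WSet = Word → Set (c ⊔ ℓ)

  record IsSubspace (P : WSet) : Set (c ⊔ ℓ) where
    field
      resp  : ∀ {u v} → u ≈w v → P u → P v
      zero∈ : P 0w
      +∈    : ∀ {u v} → P u → P v → P (u +w v)
      •∈    : ∀ a {v} → P v → P (a •w v)

  InSupp : WSet → Fin n → Set (c ⊔ ℓ)
  InSupp D i = ∃[ d ] (D d × ¬ (d i ≈ 0#))

  Decomposable : WSet → Set (lsuc (c ⊔ ℓ))
  Decomposable C =
    ∃[ D ] ∃[ D' ]
      ( IsSubspace D × IsSubspace D'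
      × (∃[ d ] (D d × NonZeroWord d))
      × (∃[ d' ] (D' d' × NonZeroWord d'))
      × (∀ w → C w → ∃[ d ] ∃[ d' ] (D d × D' d' × w ≈w (d +w d')))
      × (∀ d d' → D d → D' d' → C (d +w d'))
      × (∀ i → ¬ (InSupp D i × InSupp D' i)) )

  Indecomposable : WSet → Set (lsuc (c ⊔ ℓ))
  Indecomposable C = ¬ Decomposable C

  linComb : ∀ {k} → (Fin k → Carrier) → (Fin k → Word) → Word
  linComb {zero}  a b = 0w
  linComb {suc k} a b = (a zero •w b zero) +w linComb (λ j → a (suc j)) (λ j → b (suc j))

  Span : ∀ {k} → (Fin k → Word) → Subset k → WSet
  Span b S w = ∃[ a ] ((∀ j → j ∉ S → a j ≈ 0#) × w ≈w linComb a b)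

  record IsBasis (C : WSet) {k : ℕ} (b : Fin k → Word) : Set (c ⊔ ℓ) where
    field
      members : ∀ j → C (b j)
      indep   : ∀ a → linComb a b ≈w 0w → ∀ j → a j ≈ 0#
      spans   : ∀ w → C w → ∃[ a ] (w ≈w linComb a b)

  MinWeight : WSet → Word → Set (c ⊔ ℓ)
  MinWeight C v = C v × NonZeroWord v × (∀ w → C w → NonZeroWord w → weight v ≤ weight w)

  -- chain ∅ = B_0 ⊆ B_1 ⊆ ... ⊆ B_k = B with #B_i = i (as subsets of index set of B)
  record IsChain (k : ℕ) (B : Fin (suc k) → Subset k) : Set where
    field
      first : B zero ≡ ⊥
      last  : B (fromℕ k) ≡ ⊤
      mono  : ∀ (i : Fin k) → B (inject₁ i) ⊆ B (suc i)
      card  : ∀ i → ∣ B i ∣ ≡ toℕ i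

module Submission where

-- Join i and j when the supports of b i and b j meet. If this graph split into two parts with
-- no edge between them, the spans of the two parts would decompose C; so it is connected, and
-- its vertices can be added one at a time, each meeting an earlier one. Conversely, a
-- decomposition of the span of some of the b i must put each minimum-weight b i wholly into one
-- summand (a nonzero summand with smaller support would have smaller weight), so it would split
-- the graph on those indices.

open import Defs
open import Level using (Level)
open import Data.Nat using (ℕ; zero; suc; _<_; _≤_; z≤n; s≤s)
open import Data.Nat.Properties using (≤-refl; ≤⇒≯; <⇒≤; m≤n⇒m≤1+n)
open import Data.Fin using (Fin; zero; suc; toℕ; fromℕ; inject₁)
open import Data.Fin.Subset using (Subset; _∈_; _∉_; _⊆_; _∪_; ⁅_⁆; ∣_∣; ⊤; Empty; inside; outside)
  renaming (⊥ to ∅)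
open import Data.Fin.Subset.Properties
  using (_∈?_; nonempty?; ∈⊤; ∉⊥; ∣⊥∣≡0; ∣p∣≡n⇒p≡⊤; x∈p∪q⁻; x∈⁅y⁆⇒x≡y; x∈⁅x⁆; p⊆p∪q; q⊆p∪q; ∪-identityʳ)
open import Data.Fin.Properties using (any?; all?; ¬∀⟶∃¬; toℕ≤pred[n]; toℕ-fromℕ; toℕ-inject₁)
open import Data.Vec using (_∷_; here; there)
open import Data.Bool using (Bool; true; false; if_then_else_)
import Data.Bool.Properties as Bool
open import Data.Product using (Σ; ∃; ∃-syntax; _×_; _,_; proj₁; proj₂)
open import Data.Sum using (_⊎_; inj₁; inj₂)
open import Data.Empty using (⊥-elim)
open import Function using (_∘_)
open import Relation.Nullary using (¬_; Dec; yes; no; does)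
open import Relation.Nullary.Decidable using (¬?; _×-dec_; _⊎-dec_; dec-true; dec-false; decidable-stable)
open import Relation.Unary as U using ()
open import Relation.Binary using (Symmetric; Decidable)
open import Relation.Binary.PropositionalEquality as ≡ using (_≡_; _≢_; cong; subst)

module LinearAlgebra {c ℓ : Level} (F : FiniteField c ℓ) (n : ℕ) where
  open FiniteField F hiding (zero; q)
  open Codes F n
  open import Algebra.Properties.CommutativeSemigroup +-commutativeSemigroup using (interchange)
  open import Relation.Binary.Reasoning.Setoid setoid

  linComb-cong : ∀ {k} {a a' : Fin k → Carrier} (b : Fin k → Word) →
                 (∀ j → a j ≈ a' j) → linComb a b ≈w linComb a' b
  linComb-cong {zero}  b a≈a' t = refl
  linComb-cong {suc k} b a≈a' t =
    +-cong (*-cong (a≈a' zero) refl) (linComb-cong (b ∘ suc) (a≈a' ∘ suc) t)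

  linComb-+ : ∀ {k} (a a' : Fin k → Carrier) (b : Fin k → Word) →
              linComb (λ j → a j + a' j) b ≈w (linComb a b +w linComb a' b)
  linComb-+ {zero}  a a' b t = sym (+-identityʳ 0#)
  linComb-+ {suc k} a a' b t = begin
    (a zero + a' zero) * b zero t + linComb (λ j → a (suc j) + a' (suc j)) (b ∘ suc) t
      ≈⟨ +-cong (distribʳ (b zero t) (a zero) (a' zero)) (linComb-+ (a ∘ suc) (a' ∘ suc) (b ∘ suc) t) ⟩
    (a zero * b zero t + a' zero * b zero t) + (linComb (a ∘ suc) (b ∘ suc) t + linComb (a' ∘ suc) (b ∘ suc) t)
      ≈⟨ interchange _ _ _ _ ⟩
    linComb a b t + linComb a' b t ∎

  linComb-• : ∀ {k} (x : Carrier) (a : Fin k → Carrier) (b : Fin k → Word) →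
              linComb (λ j → x * a j) b ≈w (x •w linComb a b)
  linComb-• {zero}  x a b t = sym (zeroʳ x)
  linComb-• {suc k} x a b t = begin
    (x * a zero) * b zero t + linComb (λ j → x * a (suc j)) (b ∘ suc) t
      ≈⟨ +-cong (*-assoc x (a zero) (b zero t)) (linComb-• x (a ∘ suc) (b ∘ suc) t) ⟩
    x * (a zero * b zero t) + x * linComb (a ∘ suc) (b ∘ suc) t
      ≈⟨ distribˡ x _ _ ⟨
    x * linComb a b t ∎

  linComb-vanishes : ∀ {k} (a : Fin k → Carrier) (b : Fin k → Word) t →
                     (∀ j → a j ≈ 0# ⊎ b j t ≈ 0#) → linComb a b t ≈ 0#
  linComb-vanishes {zero}  a b t _ = refl
  linComb-vanishes {suc k} a b t a⊎b≈0 = begin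
    a zero * b zero t + linComb (a ∘ suc) (b ∘ suc) t
      ≈⟨ +-cong (term≈0 (a⊎b≈0 zero)) (linComb-vanishes (a ∘ suc) (b ∘ suc) t (a⊎b≈0 ∘ suc)) ⟩
    0# + 0#
      ≈⟨ +-identityʳ 0# ⟩
    0# ∎
    where
    term≈0 : a zero ≈ 0# ⊎ b zero t ≈ 0# → a zero * b zero t ≈ 0#
    term≈0 (inj₁ a≈0) = trans (*-cong a≈0 refl) (zeroˡ _)
    term≈0 (inj₂ b≈0) = trans (*-cong refl b≈0) (zeroʳ _)

  δ : ∀ {k} → Fin k → Fin k → Carrier
  δ zero    zero    = 1#
  δ zero    (suc _) = 0#
  δ (suc _) zero    = 0#
  δ (suc i) (suc j) = δ i j

  δ-diagonal : ∀ {k} (i : Fin k) → δ i i ≈ 1#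
  δ-diagonal zero    = refl
  δ-diagonal (suc i) = δ-diagonal i

  δ-off-diagonal : ∀ {k} {i j : Fin k} → j ≢ i → δ i j ≈ 0#
  δ-off-diagonal {i = zero}  {zero}  j≢i = ⊥-elim (j≢i ≡.refl)
  δ-off-diagonal {i = zero}  {suc j} _   = refl
  δ-off-diagonal {i = suc i} {zero}  _   = refl
  δ-off-diagonal {i = suc i} {suc j} j≢i = δ-off-diagonal (j≢i ∘ cong suc)

  linComb-δ : ∀ {k} (i : Fin k) (b : Fin k → Word) → linComb (δ i) b ≈w b i
  linComb-δ zero b t = begin
    1# * b zero t + linComb (δ zero ∘ suc) (b ∘ suc) t
      ≈⟨ +-cong (*-identityˡ _) (linComb-vanishes (δ zero ∘ suc) (b ∘ suc) t (λ _ → inj₁ refl)) ⟩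
    b zero t + 0#
      ≈⟨ +-identityʳ _ ⟩
    b zero t ∎
  linComb-δ (suc i) b t = trans (+-cong (zeroˡ _) (linComb-δ i (b ∘ suc) t)) (+-identityˡ _)

  linComb-∈ : ∀ {k} {C : WSet} → IsSubspace C → (a : Fin k → Carrier) {b : Fin k → Word} →
              (∀ j → C (b j)) → C (linComb a b)
  linComb-∈ {zero}  C-sub a b∈C = IsSubspace.zero∈ C-sub
  linComb-∈ {suc k} C-sub a b∈C =
    IsSubspace.+∈ C-sub (IsSubspace.•∈ C-sub (a zero) (b∈C zero)) (linComb-∈ C-sub (a ∘ suc) (b∈C ∘ suc))

  IsBasis⇒nonzero : ∀ {k C} {b : Fin k → Word} → IsBasis C b → ∀ i → NonZeroWord (b i)
  IsBasis⇒nonzero {b = b} basis i = ¬∀⟶∃¬ n _ (λ t → b i t ≟ 0#) λ bi≈0 →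
    1≉0 (trans (sym (δ-diagonal i)) (IsBasis.indep basis (δ i) (λ t → trans (linComb-δ i b t) (bi≈0 t)) i))

  -- Span b S is SpanWhere b (_∈ S) definitionally.
  SpanWhere : ∀ {k} → (Fin k → Word) → (Fin k → Set) → WSet
  SpanWhere b P w = ∃[ a ] ((∀ j → ¬ P j → a j ≈ 0#) × w ≈w linComb a b)

  module _ {k} (b : Fin k → Word) (P : Fin k → Set) where

    SpanWhere-isSubspace : IsSubspace (SpanWhere b P)
    SpanWhere-isSubspace = record
      { resp  = λ { u≈v (a , a-vanishes , u≈) → a , a-vanishes , λ t → trans (sym (u≈v t)) (u≈ t) }
      ; zero∈ = (λ _ → 0#) , (λ _ _ → refl) , λ t → sym (linComb-vanishes _ b t (λ _ → inj₁ refl))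
      ; +∈    = λ { (a , a-vanishes , u≈) (a' , a'-vanishes , v≈) →
                    (λ j → a j + a' j)
                  , (λ j ¬Pj → trans (+-cong (a-vanishes j ¬Pj) (a'-vanishes j ¬Pj)) (+-identityʳ 0#))
                  , λ t → trans (+-cong (u≈ t) (v≈ t)) (sym (linComb-+ a a' b t)) }
      ; •∈    = λ { x (a , a-vanishes , v≈) →
                    (λ j → x * a j)
                  , (λ j ¬Pj → trans (*-cong refl (a-vanishes j ¬Pj)) (zeroʳ x))
                  , λ t → trans (*-cong refl (v≈ t)) (sym (linComb-• x a b t)) }
      }

    b∈SpanWhere : ∀ {i} → P i → SpanWhere b P (b i)
    b∈SpanWhere {i} Pi = δ i , (λ j ¬Pj → δ-off-diagonal {i = i} {j} λ { ≡.refl → ¬Pj Pi }) , λ t → sym (linComb-δ i b t)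

    SpanWhere⊆ : ∀ {C} → IsSubspace C → (∀ j → C (b j)) → ∀ {w} → SpanWhere b P w → C w
    SpanWhere⊆ C-sub b∈C (a , _ , w≈) = IsSubspace.resp C-sub (λ t → sym (w≈ t)) (linComb-∈ C-sub a b∈C)

    SpanWhere-support : U.Decidable P → ∀ {w} → SpanWhere b P w →
                        ∀ t → ¬ w t ≈ 0# → ∃ λ i → P i × ¬ b i t ≈ 0#
    SpanWhere-support P? (a , a-vanishes , w≈) t wt≉0 =
      decidable-stable (any? λ i → P? i ×-dec ¬? (b i t ≟ 0#)) λ none →
        wt≉0 (trans (w≈ t) (linComb-vanishes a b t (term≈0 none)))
      where
      term≈0 : ¬ (∃ λ i → P i × ¬ b i t ≈ 0#) → ∀ j → a j ≈ 0# ⊎ b j t ≈ 0#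
      term≈0 none j with P? j | b j t ≟ 0#
      ... | no ¬Pj | _        = inj₁ (a-vanishes j ¬Pj)
      ... | yes _  | yes bj≈0 = inj₂ bj≈0
      ... | yes Pj | no bj≉0  = ⊥-elim (none (j , Pj , bj≉0))

  _⊆ₛ_ : ∀ {m} → (Fin m → Carrier) → (Fin m → Carrier) → Set ℓ
  u ⊆ₛ v = ∀ t → ¬ u t ≈ 0# → ¬ v t ≈ 0#

  weight-mono : ∀ {m} {u v : Fin m → Carrier} → u ⊆ₛ v → weight u ≤ weight v
  weight-mono {zero}          u⊆v = z≤n
  weight-mono {suc m} {u} {v} u⊆v with u zero ≟ 0# | v zero ≟ 0#
  ... | yes _    | yes _   = weight-mono (u⊆v ∘ suc)
  ... | yes _    | no _    = m≤n⇒m≤1+n (weight-mono (u⊆v ∘ suc))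
  ... | no u₀≉0  | yes v₀≈0 = ⊥-elim (u⊆v zero u₀≉0 v₀≈0)
  ... | no _     | no _    = s≤s (weight-mono (u⊆v ∘ suc))

  weight-strictMono : ∀ {m} {u v : Fin m → Carrier} → u ⊆ₛ v →
                      (∃ λ t → u t ≈ 0# × ¬ v t ≈ 0#) → weight u < weight v
  weight-strictMono {suc m} {u} {v} u⊆v (t , ut≈0 , vt≉0) with u zero ≟ 0# | v zero ≟ 0# | t
  ... | no u₀≉0 | yes v₀≈0 | _     = ⊥-elim (u⊆v zero u₀≉0 v₀≈0)
  ... | no u₀≉0 | no _     | zero  = ⊥-elim (u₀≉0 ut≈0)
  ... | _       | yes v₀≈0 | zero  = ⊥-elim (vt≉0 v₀≈0)
  ... | yes _   | no _     | zero  = s≤s (weight-mono (u⊆v ∘ suc))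
  ... | yes _   | yes _    | suc t = weight-strictMono (u⊆v ∘ suc) (t , ut≈0 , vt≉0)
  ... | yes _   | no _     | suc t = m≤n⇒m≤1+n (weight-strictMono (u⊆v ∘ suc) (t , ut≈0 , vt≉0))
  ... | no _    | no _     | suc t = s≤s (weight-strictMono (u⊆v ∘ suc) (t , ut≈0 , vt≉0))

  MinWeight⇒support-minimal : ∀ {C v d} → MinWeight C v → C d → NonZeroWord d → d ⊆ₛ v → v ⊆ₛ d
  MinWeight⇒support-minimal (_ , _ , minimal) Cd d≢0 d⊆v t vt≉0 dt≈0 =
    ≤⇒≯ (minimal _ Cd d≢0) (weight-strictMono d⊆v (t , dt≈0 , vt≉0))

  -- If d' ≠ 0 then supp d' ⊆ supp v, and minimality of supp v forces equality.
  MinWeight⇒⊆ₛ-summand : ∀ {C v d d'} → MinWeight C v → C d' → v ≈w (d +w d') →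
                          (∀ t → d t ≈ 0# ⊎ d' t ≈ 0#) → v ⊆ₛ d ⊎ v ⊆ₛ d'
  MinWeight⇒⊆ₛ-summand {v = v} {d} {d'} minWeight Cd' v≈d+d' disjoint with all? (λ t → d' t ≟ 0#)
  ... | yes d'≈0 = inj₁ λ t vt≉0 dt≈0 → vt≉0 (begin
    v t           ≈⟨ v≈d+d' t ⟩
    d t + d' t    ≈⟨ +-cong dt≈0 (d'≈0 t) ⟩
    0# + 0#       ≈⟨ +-identityʳ 0# ⟩
    0#            ∎)
  ... | no d'≉0 = inj₂ (MinWeight⇒support-minimal minWeight Cd' (¬∀⟶∃¬ n _ (λ t → d' t ≟ 0#) d'≉0) d'⊆v)
    where
    d'⊆v : d' ⊆ₛ v
    d'⊆v t d't≉0 vt≈0 with disjoint t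
    ... | inj₂ d't≈0 = d't≉0 d't≈0
    ... | inj₁ dt≈0  = d't≉0 (begin
      d' t          ≈⟨ +-identityˡ (d' t) ⟨
      0# + d' t     ≈⟨ +-cong dt≈0 refl ⟨
      d t + d' t    ≈⟨ v≈d+d' t ⟨
      v t           ≈⟨ vt≈0 ⟩
      0#            ∎)

∣p∪⁅x⁆∣≡1+∣p∣ : ∀ {k} {p : Subset k} {x} → x ∉ p → ∣ p ∪ ⁅ x ⁆ ∣ ≡ suc ∣ p ∣
∣p∪⁅x⁆∣≡1+∣p∣ {p = inside  ∷ p} {zero}  x∉p = ⊥-elim (x∉p here)
∣p∪⁅x⁆∣≡1+∣p∣ {p = outside ∷ p} {zero}  x∉p = cong (suc ∘ ∣_∣) (∪-identityʳ p)
∣p∪⁅x⁆∣≡1+∣p∣ {p = inside  ∷ p} {suc x} x∉p = cong suc (∣p∪⁅x⁆∣≡1+∣p∣ (x∉p ∘ there))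
∣p∪⁅x⁆∣≡1+∣p∣ {p = outside ∷ p} {suc x} x∉p = ∣p∪⁅x⁆∣≡1+∣p∣ (x∉p ∘ there)

∣p∣<n⇒∃∉ : ∀ {k} {p : Subset k} → ∣ p ∣ < k → ∃ λ x → x ∉ p
∣p∣<n⇒∃∉ {p = outside ∷ p} _           = zero , λ ()
∣p∣<n⇒∃∉ {p = inside  ∷ p} (s≤s |p|<k) with ∣p∣<n⇒∃∉ |p|<k
... | x , x∉p = suc x , λ { (there x∈p) → x∉p x∈p }

∈-∪-⁅⁆ : ∀ {k} {p : Subset k} {x y} → x ∈ p ∪ ⁅ y ⁆ → x ∈ p ⊎ x ≡ y
∈-∪-⁅⁆ {p = p} {y = y} x∈ with x∈p∪q⁻ p ⁅ y ⁆ x∈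
... | inj₁ x∈p = inj₁ x∈p
... | inj₂ x∈y = inj₂ (x∈⁅y⁆⇒x≡y y x∈y)

module Graph {a} {k : ℕ} (_~_ : Fin k → Fin k → Set a) (~-sym : Symmetric _~_) (_~?_ : Decidable _~_) where

  Split : Subset k → Set a
  Split S = Σ (Fin k → Bool) λ σ → (∀ β → ∃ λ i → i ∈ S × σ i ≡ β)
                                  × (∀ {i j} → i ∈ S → j ∈ S → σ i ≢ σ j → ¬ i ~ j)

  Connected : Subset k → Set a
  Connected S = ¬ Split S

  ∅-connected : Connected ∅
  ∅-connected (_ , colours , _) = ∉⊥ (proj₁ (proj₂ (colours true)))

  -- An edge to S forces j to take the colour of its neighbour, so a split of S ∪ {j} restricts to S.
  connected-∪-⁅⁆ : ∀ {S j} → Connected S → Empty S ⊎ (∃ λ i → i ∈ S × i ~ j) → Connected (S ∪ ⁅ j ⁆)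
  connected-∪-⁅⁆ {S} {j} _ (inj₁ S-empty) (σ , colours , _) =
    Bool.not-¬ (colour-of-j true) (colour-of-j false)
    where
    colour-of-j : ∀ β → σ j ≡ β
    colour-of-j β with colours β
    ... | x , x∈ , σx≡β with ∈-∪-⁅⁆ x∈
    ...   | inj₁ x∈S  = ⊥-elim (S-empty (x , x∈S))
    ...   | inj₂ ≡.refl = σx≡β
  connected-∪-⁅⁆ {S} {j} S-connected (inj₂ (i , i∈S , i~j)) (σ , colours , noCross) =
    S-connected (σ , colours′ , λ x∈S y∈S → noCross (p⊆p∪q ⁅ j ⁆ x∈S) (p⊆p∪q ⁅ j ⁆ y∈S))
    where
    σi≡σj : σ i ≡ σ j
    σi≡σj = decidable-stable (σ i Bool.≟ σ j) λ σi≢σj →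
      noCross (p⊆p∪q ⁅ j ⁆ i∈S) (q⊆p∪q S ⁅ j ⁆ (x∈⁅x⁆ j)) σi≢σj i~j
    colours′ : ∀ β → ∃ λ x → x ∈ S × σ x ≡ β
    colours′ β with colours β
    ... | x , x∈ , σx≡β with ∈-∪-⁅⁆ x∈
    ...   | inj₁ x∈S    = x , x∈S , σx≡β
    ...   | inj₂ ≡.refl = i , i∈S , ≡.trans σi≡σj σx≡β

  membership-split : ∀ {S i j} → i ∈ S → j ∉ S → (∀ {x y} → x ∈ S → y ∉ S → ¬ x ~ y) → Split ⊤
  membership-split {S} {i} {j} i∈S j∉S closed = σ , colours , noCross
    where
    σ : Fin k → Bool
    σ x = does (x ∈? S)
    colours : ∀ β → ∃ λ x → x ∈ ⊤ × σ x ≡ β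
    colours true  = i , ∈⊤ , dec-true (i ∈? S) i∈S
    colours false = j , ∈⊤ , dec-false (j ∈? S) j∉S
    noCross : ∀ {x y} → x ∈ ⊤ → y ∈ ⊤ → σ x ≢ σ y → ¬ x ~ y
    noCross {x} {y} _ _ σx≢σy with x ∈? S | y ∈? S
    ... | yes x∈S | no y∉S  = closed x∈S y∉S
    ... | no x∉S  | yes y∈S = closed y∈S x∉S ∘ ~-sym
    ... | yes _   | yes _   = ⊥-elim (σx≢σy ≡.refl)
    ... | no _    | no _    = ⊥-elim (σx≢σy ≡.refl)

  Extends : Subset k → Fin k → Set a
  Extends S j = j ∉ S × (Empty S ⊎ ∃ λ i → i ∈ S × i ~ j)

  extends? : ∀ S → U.Decidable (Extends S)
  extends? S j = ¬? (j ∈? S) ×-dec (¬? (nonempty? S) ⊎-dec any? (λ i → (i ∈? S) ×-dec (i ~? j)))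

  step : (S : Subset k) → Dec (∃ (Extends S)) → Subset k
  step S (yes (j , _)) = S ∪ ⁅ j ⁆
  step S (no _)        = S

  ⊆-step : ∀ S e → S ⊆ step S e
  ⊆-step S (yes (j , _)) = p⊆p∪q ⁅ j ⁆
  ⊆-step S (no _)        = λ x∈S → x∈S

  grow : ℕ → Subset k
  grow zero    = ∅
  grow (suc m) = step (grow m) (any? (extends? (grow m)))

  chain : Fin (suc k) → Subset k
  chain = grow ∘ toℕ

  chain-mono : ∀ i → chain (inject₁ i) ⊆ chain (suc i)
  chain-mono i = subst (λ m → grow m ⊆ grow (suc (toℕ i))) (≡.sym (toℕ-inject₁ i)) (⊆-step _ (any? (extends? _)))

  module _ (⊤-connected : Connected ⊤) where

    extension-exists : ∀ {S} → ∣ S ∣ < k → ∃ (Extends S)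
    extension-exists {S} |S|<k with ∣p∣<n⇒∃∉ |S|<k | nonempty? S
    ... | j , j∉S | no S-empty     = j , j∉S , inj₁ S-empty
    ... | j , j∉S | yes (i , i∈S) = decidable-stable (any? (extends? S)) λ no-extension →
      ⊤-connected (membership-split i∈S j∉S λ x∈S y∉S x~y → no-extension (_ , y∉S , inj₂ (_ , x∈S , x~y)))

    step-invariant : ∀ {S m} → ∣ S ∣ ≡ m → m < k → Connected S → (e : Dec (∃ (Extends S))) →
                     ∣ step S e ∣ ≡ suc m × Connected (step S e)
    step-invariant |S|≡m _ S-connected (yes (j , j∉S , attached)) =
      ≡.trans (∣p∪⁅x⁆∣≡1+∣p∣ j∉S) (cong suc |S|≡m) , connected-∪-⁅⁆ S-connected attached
    step-invariant ≡.refl m<k _ (no no-extension) = ⊥-elim (no-extension (extension-exists m<k))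

    grow-invariant : ∀ m → m ≤ k → ∣ grow m ∣ ≡ m × Connected (grow m)
    grow-invariant zero    _   = ∣⊥∣≡0 k , ∅-connected
    grow-invariant (suc m) m<k =
      let |S|≡m , S-connected = grow-invariant m (<⇒≤ m<k) in
      step-invariant |S|≡m m<k S-connected (any? (extends? (grow m)))

    chain-card : ∀ i → ∣ chain i ∣ ≡ toℕ i
    chain-card i = proj₁ (grow-invariant (toℕ i) (toℕ≤pred[n] i))

    chain-connected : ∀ i → Connected (chain i)
    chain-connected i = proj₂ (grow-invariant (toℕ i) (toℕ≤pred[n] i))

    chain-last : chain (fromℕ k) ≡ ⊤
    chain-last = ≡.trans (cong grow (toℕ-fromℕ k)) (∣p∣≡n⇒p≡⊤ (proj₁ (grow-invariant k ≤-refl)))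

module SupportGraph {c ℓ : Level} (F : FiniteField c ℓ) (n : ℕ) {k : ℕ}
    {C : Codes.WSet F n} (C-subspace : Codes.IsSubspace F n C)
    {b : Fin k → Codes.Word F n} (basis : Codes.IsBasis F n C b) where
  open FiniteField F hiding (zero; q)
  open Codes F n
  open LinearAlgebra F n

  _~_ : Fin k → Fin k → Set ℓ
  i ~ j = ∃ λ t → ¬ b i t ≈ 0# × ¬ b j t ≈ 0#

  ~-sym : Symmetric _~_
  ~-sym (t , bit≉0 , bjt≉0) = t , bjt≉0 , bit≉0

  _~?_ : Decidable _~_
  i ~? j = any? λ t → ¬? (b i t ≟ 0#) ×-dec ¬? (b j t ≟ 0#)

  open Graph _~_ ~-sym _~?_ public

  Span⊆C : ∀ {P w} → SpanWhere b P w → C w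
  Span⊆C = SpanWhere⊆ b _ C-subspace (IsBasis.members basis)

  keep : Bool → Bool → Carrier → Carrier
  keep β γ x = if does (γ Bool.≟ β) then x else 0#

  keep-vanishes : ∀ {β γ} x → γ ≢ β → keep β γ x ≈ 0#
  keep-vanishes {β} {γ} x γ≢β with γ Bool.≟ β
  ... | yes γ≡β = ⊥-elim (γ≢β γ≡β)
  ... | no _    = refl

  keep-split : ∀ γ x → x ≈ keep true γ x + keep false γ x
  keep-split true  x = sym (+-identityʳ x)
  keep-split false x = sym (+-identityˡ x)

  -- The colour classes of a split span complementary subcodes with disjoint supports.
  Split⊤⇒Decomposable : Split ⊤ → Decomposable C
  Split⊤⇒Decomposable (σ , colours , noCross) =
      Part true , Part false , SpanWhere-isSubspace b _ , SpanWhere-isSubspace b _ , nonzero true , nonzero false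
    , decompose , (λ d d' Dd D'd' → IsSubspace.+∈ C-subspace (Span⊆C Dd) (Span⊆C D'd')) , disjoint
    where
    Part : Bool → WSet
    Part β = SpanWhere b (λ j → σ j ≡ β)

    nonzero : ∀ β → ∃[ d ] (Part β d × NonZeroWord d)
    nonzero β with colours β
    ... | i , _ , σi≡β = b i , b∈SpanWhere b _ σi≡β , IsBasis⇒nonzero basis i

    decompose : ∀ w → C w → ∃[ d ] ∃[ d' ] (Part true d × Part false d' × w ≈w (d +w d'))
    decompose w Cw with IsBasis.spans basis w Cw
    ... | a , w≈ = linComb (part true) b , linComb (part false) b
                 , (part true , (λ j → keep-vanishes (a j)) , λ _ → refl)
                 , (part false , (λ j → keep-vanishes (a j)) , λ _ → refl)
                 , λ t → trans (w≈ t) (trans (linComb-cong b (λ j → keep-split (σ j) (a j)) t)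
                                             (linComb-+ (part true) (part false) b t))
      where
      part : Bool → Fin k → Carrier
      part β j = keep β (σ j) (a j)

    disjoint : ∀ t → ¬ (InSupp (Part true) t × InSupp (Part false) t)
    disjoint t ((d , Dd , dt≉0) , (d' , D'd' , d't≉0))
      with SpanWhere-support b _ (λ j → σ j Bool.≟ true) Dd t dt≉0
         | SpanWhere-support b _ (λ j → σ j Bool.≟ false) D'd' t d't≉0
    ... | i , σi≡true , bit≉0 | j , σj≡false , bjt≉0 =
      noCross ∈⊤ ∈⊤ (λ σi≡σj → Bool.not-¬ σi≡true (≡.trans σi≡σj σj≡false)) (t , bit≉0 , bjt≉0)

  -- A minimum-weight b i cannot straddle the two parts of a decomposition, so its side colours i.
  Decomposable⇒Split : (∀ j → MinWeight C (b j)) → ∀ S → Decomposable (Span b S) → Split S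
  Decomposable⇒Split minWeight S (D , D' , D-sub , D'-sub , D≢0 , D'≢0 , decompose , sum∈ , disjoint) =
    σ , colours , noCross
    where
    Part : Bool → WSet
    Part true  = D
    Part false = D'

    Part-nonzero : ∀ β → ∃[ d ] (Part β d × NonZeroWord d)
    Part-nonzero true  = D≢0
    Part-nonzero false = D'≢0

    Part⊆Span : ∀ β {w} → Part β w → Span b S w
    Part⊆Span true  {w} Dw  = IsSubspace.resp (SpanWhere-isSubspace b _) (λ t → +-identityʳ (w t))
                                (sum∈ w 0w Dw (IsSubspace.zero∈ D'-sub))
    Part⊆Span false {w} D'w = IsSubspace.resp (SpanWhere-isSubspace b _) (λ t → +-identityˡ (w t))
                                (sum∈ 0w w (IsSubspace.zero∈ D-sub) D'w)

    Parts-disjoint : ∀ {β γ} t → β ≢ γ → InSupp (Part β) t → ¬ InSupp (Part γ) t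
    Parts-disjoint {true}  {true}  t β≢γ _  _  = β≢γ ≡.refl
    Parts-disjoint {true}  {false} t _   s  s' = disjoint t (s , s')
    Parts-disjoint {false} {true}  t _   s  s' = disjoint t (s' , s)
    Parts-disjoint {false} {false} t β≢γ _  _  = β≢γ ≡.refl

    pointwise-disjoint : ∀ {d d'} → D d → D' d' → ∀ t → d t ≈ 0# ⊎ d' t ≈ 0#
    pointwise-disjoint {d} {d'} Dd D'd' t with d t ≟ 0# | d' t ≟ 0#
    ... | yes dt≈0 | _          = inj₁ dt≈0
    ... | no _     | yes d't≈0  = inj₂ d't≈0
    ... | no dt≉0  | no d't≉0   = ⊥-elim (disjoint t ((d , Dd , dt≉0) , (d' , D'd' , d't≉0)))

    side : ∀ {i} → i ∈ S → Σ Bool λ β → ∀ t → ¬ b i t ≈ 0# → InSupp (Part β) t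
    side {i} i∈S with decompose (b i) (b∈SpanWhere b (_∈ S) i∈S)
    ... | d , d' , Dd , D'd' , bi≈d+d'
      with MinWeight⇒⊆ₛ-summand (minWeight i) (Span⊆C (Part⊆Span false D'd')) bi≈d+d' (pointwise-disjoint Dd D'd')
    ... | inj₁ bi⊆d  = true  , λ t bit≉0 → d  , Dd  , bi⊆d  t bit≉0
    ... | inj₂ bi⊆d' = false , λ t bit≉0 → d' , D'd' , bi⊆d' t bit≉0

    -- Indices outside S get an arbitrary colour.
    σ : Fin k → Bool
    σ i with i ∈? S
    ... | yes i∈S = proj₁ (side i∈S)
    ... | no _    = true

    σ-side : ∀ {i} → i ∈ S → ∀ t → ¬ b i t ≈ 0# → InSupp (Part (σ i)) t
    σ-side {i} i∈S with i ∈? S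
    ... | yes i∈S′ = proj₂ (side i∈S′)
    ... | no i∉S   = ⊥-elim (i∉S i∈S)

    colours : ∀ β → ∃ λ i → i ∈ S × σ i ≡ β
    colours β with Part-nonzero β
    ... | d , Pd , t , dt≉0 with SpanWhere-support b (_∈ S) (_∈? S) (Part⊆Span β Pd) t dt≉0
    ...   | i , i∈S , bit≉0 = i , i∈S , decidable-stable (σ i Bool.≟ β) λ σi≢β →
            Parts-disjoint t σi≢β (σ-side i∈S t bit≉0) (d , Pd , dt≉0)

    noCross : ∀ {i j} → i ∈ S → j ∈ S → σ i ≢ σ j → ¬ i ~ j
    noCross i∈S j∈S σi≢σj (t , bit≉0 , bjt≉0) =
      Parts-disjoint t σi≢σj (σ-side i∈S t bit≉0) (σ-side j∈S t bjt≉0)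

lemma6 : {c ℓ : Level} (F : FiniteField c ℓ) (n k : ℕ)
    → (C : Codes.WSet F n) → Codes.IsSubspace F n C
    → Codes.Indecomposable F n C
    → (b : Fin k → Codes.Word F n)
    → Codes.IsBasis F n C b
    → (∀ j → Codes.MinWeight F n C (b j))
    → Σ (Fin (suc k) → Subset k) (λ B →
        Codes.IsChain F n k B × (∀ i → Codes.Indecomposable F n (Codes.Span F n b (B i))))
lemma6 F n k C C-subspace C-indecomposable b basis minWeight =
  chain , isChain , λ i → chain-connected ⊤-connected i ∘ Decomposable⇒Split minWeight (chain i)
  where
  open SupportGraph F n C-subspace basis
  ⊤-connected : Connected ⊤
  ⊤-connected = C-indecomposable ∘ Split⊤⇒Decomposable
  isChain : Codes.IsChain F n k chain
  isChain = record
    { first = ≡.refl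
    ; last  = chain-last ⊤-connected
    ; mono  = chain-mono
    ; card  = chain-card ⊤-connected
    }
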